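{- Let $D\subseteq\{0,1\}^n$ be a domain. $D$ admits a binary aggregator $(f_1,\ldots,f_n)$ which is not a projection aggregator if and only if there exists a renamable partially Horn formula $\phi$ whose set of models equals $D$.
   Context: Standing assumption: domains $D\subseteq\{0,1\}^n$ are non-degenerate, i.e. the projection of $D$ onto each coordinate is $\{0,1\}$. A binary aggregator for $D$ is an $n$-tuple $(f_1,\ldots,f_n)$ of unanimous functions $f_j:\{0,1\}^2\to\{0,1\}$ such that for all $x,y\in D$, $(f_1(x_1,y_1),\ldots,f_n(x_n,y_n))\in D$; it is a projection aggregator if each $f_j$ is a projection ${\rm pr}^2_1$ or ${\rm pr}^2_2$ (the only other unanimous binary functions being $\wedge$ and $\vee$). A Horn clause has at most one positive literal. Renaming a set $W$ of variables means replacing every occurrence of $x$ by $\neg x$ and of $\neg x$ by $x$, for $x\in W$. A CNF formula over $V$ is partially Horn if there is a non-empty $V_0\subseteq V$ such that (i) every clause containing only variables from $V_0$ is Horn and (ii) variables of $V_0$ appear only negatively (if at all) in clauses that also contain variables not in $V_0$; it is renamable partially Horn if some variables can be renamed so that it becomes partially Horn. -}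

module Defs where

open import Data.Bool using (Bool; true; false; not)
open import Data.Nat using (ℕ; _≤_)
open import Data.Fin using (Fin)
open import Data.Vec using (Vec; lookup; tabulate)
open import Data.List using (List; length; filter)
open import Data.List.Relation.Unary.All using (All)
open import Data.List.Relation.Unary.Any using (Any)
open import Data.Product using (Σ; ∃; _×_)
open import Relation.Binary.PropositionalEquality using (_≡_)
open import Relation.Nullary using (¬_)
open import Function.Bundles using (_⇔_)
open import Data.Bool.Properties using () renaming (_≟_ to _≟ᵇ_)
open import Relation.Nullary.Decidable using (yes; no)

-- Assignments / points of {0,1}^n (false = 0, true = 1).
Point : ℕ → Set
Point n = Vec Bool n

Domain : ℕ → Set
Domain n = Point n → Bool

_∈D_ : ∀ {n} → Point n → Domain n → Set
x ∈D D = D x ≡ true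

NonDegenerate : ∀ {n} → Domain n → Set
NonDegenerate {n} D = (j : Fin n) (b : Bool) → ∃ λ x → x ∈D D × lookup x j ≡ b

Unanimous : (Bool → Bool → Bool) → Set
Unanimous f = ∀ b → f b b ≡ b

applyAgg : ∀ {n} → (Fin n → Bool → Bool → Bool) → Point n → Point n → Point n
applyAgg f x y = tabulate λ j → f j (lookup x j) (lookup y j)

IsBinaryAggregator : ∀ {n} → Domain n → (Fin n → Bool → Bool → Bool) → Set
IsBinaryAggregator {n} D f =
  ((j : Fin n) → Unanimous (f j)) ×
  (∀ x y → x ∈D D → y ∈D D → applyAgg f x y ∈D D)

IsPr₁ : (Bool → Bool → Bool) → Set
IsPr₁ f = ∀ a b → f a b ≡ a

IsPr₂ : (Bool → Bool → Bool) → Set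
IsPr₂ f = ∀ a b → f a b ≡ b

data IsProjection (f : Bool → Bool → Bool) : Set where
  isPr₁ : IsPr₁ f → IsProjection f
  isPr₂ : IsPr₂ f → IsProjection f

IsProjectionAggregator : ∀ {n} → (Fin n → Bool → Bool → Bool) → Set
IsProjectionAggregator {n} f = (j : Fin n) → IsProjection (f j)

record Literal (n : ℕ) : Set where
  constructor lit
  field
    var      : Fin n
    positive : Bool
open Literal public

Clause : ℕ → Set
Clause n = List (Literal n)

CNF : ℕ → Set
CNF n = List (Clause n)

SatLit : ∀ {n} → Point n → Literal n → Set
SatLit x l = lookup x (var l) ≡ positive l

SatClause : ∀ {n} → Point n → Clause n → Set
SatClause x c = Any (SatLit x) c

Models : ∀ {n} → CNF n → Point n → Set
Models φ x = All (SatClause x) φ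

IsPositive : ∀ {n} → Literal n → Set
IsPositive l = positive l ≡ true

posLits : ∀ {n} → Clause n → Clause n
posLits = filter (λ l → positive l ≟ᵇ true)

HornClause : ∀ {n} → Clause n → Set
HornClause c = length (posLits c) ≤ 1

VarSet : ℕ → Set
VarSet n = Fin n → Bool

InSet : ∀ {n} → VarSet n → Literal n → Set
InSet V₀ l = V₀ (var l) ≡ true

NotInSet : ∀ {n} → VarSet n → Literal n → Set
NotInSet V₀ l = V₀ (var l) ≡ false

PartiallyHornWith : ∀ {n} → VarSet n → CNF n → Set
PartiallyHornWith {n} V₀ φ =
  (∃ λ (j : Fin n) → V₀ j ≡ true) ×
  All (λ c → All (InSet V₀) c → HornClause c) φ ×
  All (λ c → Any (NotInSet V₀) c → All (λ l → InSet V₀ l → positive l ≡ false) c) φ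

PartiallyHorn : ∀ {n} → CNF n → Set
PartiallyHorn {n} φ = Σ (VarSet n) λ V₀ → PartiallyHornWith V₀ φ

renameLit : ∀ {n} → VarSet n → Literal n → Literal n
renameLit W (lit v s) with W v
... | true  = lit v (not s)
... | false = lit v s

rename : ∀ {n} → VarSet n → CNF n → CNF n
rename W = Data.List.map (Data.List.map (renameLit W))

RenamablePartiallyHorn : ∀ {n} → CNF n → Set
RenamablePartiallyHorn {n} φ = Σ (VarSet n) λ W → PartiallyHorn (rename W φ)

ModelsEq : ∀ {n} → CNF n → Domain n → Set
ModelsEq φ D = ∀ x → (x ∈D D ⇔ Models φ x)

-- Let V₀ be the coordinates where a non-projection aggregator f is ∧ or ∨ (it is
-- a projection elsewhere) and W those where it is ∨. The aggregator
-- (x , y) ↦ f (f x y) (f y x) is, after renaming W, the partial meet taking x ∧ y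
-- on V₀ and x off V₀: projections collapse to their first argument and De Morgan
-- turns ∨ into ∧. Conversely, the models of a formula that is partially Horn
-- with respect to V₀ are closed under this partial meet, and undoing the
-- renaming yields an aggregator that is ∧ or ∨ on V₀ ≠ ∅.
-- It remains to define a set E closed under the partial meet by a partially Horn
-- formula: each z ∉ E is excluded by one clause. Either no member of E agrees
-- with z off V₀ and lies above it on V₀, and the clause says "differ from z off
-- V₀ or at a 1 of z in V₀"; or some 0 of z in V₀ is forced to 1 in E by the 1s of
-- z in V₀, a Horn implication. Otherwise z is the partial meet of members of E.

module Submission where

open import Defs
open import Data.Nat using (ℕ; zero; suc; _≤_; z≤n; s≤s)
open import Data.Fin using (Fin)
open import Data.Bool using (Bool; true; false; not; _∧_; _∨_; _xor_; if_then_else_)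
open import Data.Bool.Properties using (not-involutive; not-¬; ¬-not; ∧-idem; ∨-idem; ∧-zeroʳ)
  renaming (_≟_ to _≟ᵇ_)
open import Data.Product using (Σ; _×_; _,_; ∃; proj₁; proj₂)
open import Data.Sum using (_⊎_; inj₁; inj₂)
open import Data.Vec using ([]; _∷_; lookup; tabulate)
open import Data.Vec.Properties using (lookup∘tabulate; tabulate∘lookup; tabulate-cong)
open import Data.List using (List; []; _∷_; _++_; map; length; filter; allFin)
open import Data.List.Properties using (map-∘; map-cong; map-id; filter-none)
open import Data.List.Relation.Unary.All as All using (All; []; _∷_)
import Data.List.Relation.Unary.All.Properties as Allₚ
open import Data.List.Relation.Unary.Any as Any using (Any; here; there)
import Data.List.Relation.Unary.Any.Properties as Anyₚ
open import Relation.Binary.PropositionalEquality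
open import Function using (_∘_; case_of_)
open import Function.Bundles using (_⇔_; mk⇔; Equivalence)
import Function.Properties.Equivalence as ⇔
open import Relation.Nullary using (¬_; Dec; yes; no)
open import Relation.Nullary.Decidable using (map′; _→-dec_; _×-dec_; ¬?)
open import Data.Fin.Properties using (any?; all?)
open import Data.List.Membership.Propositional using (_∈_; lose)
open import Data.List.Membership.Propositional.Properties
  using (∈-allFin; ∈-map⁺; ∈-map⁻; ∈-filter⁺; ∈-filter⁻; ∈-++⁺ˡ; ∈-++⁺ʳ)
open import Data.Empty using (⊥-elim)

private variable n : ℕ

pointwise⇒≡ : {u v : Point n} → (∀ j → lookup u j ≡ lookup v j) → u ≡ v
pointwise⇒≡ {u = u} {v} u≗v = begin
  u                   ≡⟨ tabulate∘lookup u ⟨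
  tabulate (lookup u) ≡⟨ tabulate-cong u≗v ⟩
  tabulate (lookup v) ≡⟨ tabulate∘lookup v ⟩
  v                   ∎
  where open ≡-Reasoning

lookup-applyAgg : ∀ (f : Fin n → Bool → Bool → Bool) x y j →
                  lookup (applyAgg f x y) j ≡ f j (lookup x j) (lookup y j)
lookup-applyAgg f x y = lookup∘tabulate _

xor-involutive : ∀ w a → w xor (w xor a) ≡ a
xor-involutive true  a = not-involutive a
xor-involutive false a = refl

renamePoint : VarSet n → Point n → Point n
renamePoint W x = tabulate λ j → W j xor lookup x j

lookup-renamePoint : ∀ W (x : Point n) j → lookup (renamePoint W x) j ≡ W j xor lookup x j
lookup-renamePoint W x = lookup∘tabulate _

renamePoint-involutive : ∀ W (x : Point n) → renamePoint W (renamePoint W x) ≡ x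
renamePoint-involutive W x = pointwise⇒≡ λ j → begin
  lookup (renamePoint W (renamePoint W x)) j ≡⟨ lookup-renamePoint W (renamePoint W x) j ⟩
  W j xor lookup (renamePoint W x) j         ≡⟨ cong (W j xor_) (lookup-renamePoint W x j) ⟩
  W j xor (W j xor lookup x j)               ≡⟨ xor-involutive (W j) (lookup x j) ⟩
  lookup x j                                 ∎
  where open ≡-Reasoning

renameLit-involutive : ∀ W (l : Literal n) → renameLit W (renameLit W l) ≡ l
renameLit-involutive W (lit v s) with W v in e
... | true  rewrite e = cong (lit v) (not-involutive s)
... | false rewrite e = refl

rename-involutive : ∀ W (φ : CNF n) → rename W (rename W φ) ≡ φ
rename-involutive W = map-involutive (map-involutive (renameLit-involutive W))
  where
  map-involutive : ∀ {A : Set} {f : A → A} → (∀ a → f (f a) ≡ a) → ∀ as → map f (map f as) ≡ as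
  map-involutive f-inv as = trans (sym (map-∘ as)) (trans (map-cong f-inv as) (map-id as))

satLit-renameLit : ∀ W (x : Point n) l → SatLit x (renameLit W l) ⇔ SatLit (renamePoint W x) l
satLit-renameLit W x (lit v s) rewrite lookup-renamePoint W x v with W v
... | true  = mk⇔ (λ p → trans (cong not p) (not-involutive s))
                  (λ p → trans (sym (not-involutive _)) (cong not p))
... | false = mk⇔ (λ p → p) (λ p → p)

sat-rename : ∀ W (x : Point n) c → SatClause x (map (renameLit W) c) ⇔ SatClause (renamePoint W x) c
sat-rename W x c = mk⇔ (Any.map (Equivalence.to (satLit-renameLit W x _)) ∘ Anyₚ.map⁻)
                       (Anyₚ.map⁺ ∘ Any.map (Equivalence.from (satLit-renameLit W x _)))

models-rename : ∀ W (x : Point n) φ → Models (rename W φ) x ⇔ Models φ (renamePoint W x)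
models-rename W x φ = mk⇔ (All.map (Equivalence.to (sat-rename W x _)) ∘ Allₚ.map⁻)
                          (Allₚ.map⁺ ∘ All.map (Equivalence.from (sat-rename W x _)))

modelsEq-rename : ∀ W {φ} {D : Domain n} → ModelsEq φ D → ModelsEq (rename W φ) (D ∘ renamePoint W)
modelsEq-rename W {φ} φ≈D x = ⇔.trans (φ≈D (renamePoint W x)) (⇔.sym (models-rename W x φ))

modelsEq-resp : ∀ {φ} {D D′ : Domain n} → D ≗ D′ → ModelsEq φ D → ModelsEq φ D′
modelsEq-resp {φ = φ} D≗D′ φ≈D x = subst (λ b → (b ≡ true) ⇔ Models φ x) (D≗D′ x) (φ≈D x)

ClosedUnder : Domain n → (Point n → Point n → Point n) → Set
ClosedUnder D g = ∀ x y → x ∈D D → y ∈D D → g x y ∈D D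

meetIf : Bool → Bool → Bool → Bool
meetIf v a b = if v then a ∧ b else a

meetOn : VarSet n → Point n → Point n → Point n
meetOn V₀ = applyAgg (meetIf ∘ V₀)

lookup-meetOn : ∀ V₀ (x y : Point n) j → lookup (meetOn V₀ x y) j ≡ meetIf (V₀ j) (lookup x j) (lookup y j)
lookup-meetOn V₀ = lookup-applyAgg (meetIf ∘ V₀)

lookup-meetOn-∈ : ∀ V₀ (x y : Point n) {j} → V₀ j ≡ true → lookup (meetOn V₀ x y) j ≡ lookup x j ∧ lookup y j
lookup-meetOn-∈ V₀ x y {j} j∈V₀ rewrite lookup-meetOn V₀ x y j | j∈V₀ = refl

lookup-meetOn-∉ : ∀ V₀ (x y : Point n) {j} → V₀ j ≡ false → lookup (meetOn V₀ x y) j ≡ lookup x j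
lookup-meetOn-∉ V₀ x y {j} j∉V₀ rewrite lookup-meetOn V₀ x y j | j∉V₀ = refl

Negative : Literal n → Set
Negative l = positive l ≡ false

InsideHorn : VarSet n → Clause n → Set
InsideHorn V₀ c = All (InSet V₀) c → HornClause c

NegativeInside : VarSet n → Clause n → Set
NegativeInside V₀ c = Any (NotInSet V₀) c → All (λ l → InSet V₀ l → Negative l) c

PartiallyHornClause : VarSet n → Clause n → Set
PartiallyHornClause V₀ c = InsideHorn V₀ c × NegativeInside V₀ c

partiallyHornWith⇔ : ∀ {V₀ : VarSet n} {φ} →
  PartiallyHornWith V₀ φ ⇔ ((∃ λ j → V₀ j ≡ true) × All (PartiallyHornClause V₀) φ)
partiallyHornWith⇔ = mk⇔ (λ (j , hs , ns) → j , All.zip (hs , ns))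
                         (λ (j , hns) → j , All.unzip hns)

posLits-negative : ∀ {c : Clause n} → All Negative c → posLits c ≡ []
posLits-negative = filter-none _ ∘ All.map not-¬

negative-posLits : ∀ (c : Clause n) → length (posLits c) ≤ 0 → All Negative c
negative-posLits []                 _  = []
negative-posLits (lit v false ∷ c) c⁻ = refl ∷ negative-posLits c c⁻

Any-mapAll : ∀ {A : Set} {P Q : A → Set} {xs} → All (λ a → P a → Q a) xs → Any P xs → Any Q xs
Any-mapAll (f ∷ _)  (here p)  = here (f p)
Any-mapAll (_ ∷ fs) (there p) = there (Any-mapAll fs p)

negativeInside⇒partiallyHorn : ∀ {V₀ : VarSet n} {c} →
  All (λ l → InSet V₀ l → Negative l) c → PartiallyHornClause V₀ c
negativeInside⇒partiallyHorn {c = c} c⁻ = horn , λ _ → c⁻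
  where
  horn : InsideHorn _ c
  horn c∈V₀ rewrite posLits-negative (All.zipWith (λ (l⁻ , l∈V₀) → l⁻ l∈V₀) (c⁻ , c∈V₀)) = z≤n

inside⇒partiallyHorn : ∀ {V₀ : VarSet n} {c} → All (InSet V₀) c → HornClause c → PartiallyHornClause V₀ c
inside⇒partiallyHorn c∈V₀ horn =
  (λ _ → horn) , λ outside → ⊥-elim (Allₚ.All¬⇒¬Any (All.map not-¬ c∈V₀) outside)

horn-∷-negative : ∀ {c : Clause n} k → All Negative c → HornClause (lit k true ∷ c)
horn-∷-negative k c⁻ rewrite posLits-negative c⁻ = s≤s z≤n

module _ {V₀ : VarSet n} {x y : Point n} where

  satLit-meetOn-∉ : ∀ {l} → NotInSet V₀ l → SatLit x l → SatLit (meetOn V₀ x y) l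
  satLit-meetOn-∉ l∉V₀ x⊨l = trans (lookup-meetOn-∉ V₀ x y l∉V₀) x⊨l

  satLit-meetOn-both : ∀ {l} → InSet V₀ l → SatLit x l → SatLit y l → SatLit (meetOn V₀ x y) l
  satLit-meetOn-both {l} l∈V₀ x⊨l y⊨l =
    trans (lookup-meetOn-∈ V₀ x y l∈V₀) (trans (cong₂ _∧_ x⊨l y⊨l) (∧-idem (positive l)))

  satLit-meetOn-negative : ∀ {l} → InSet V₀ l → Negative l →
                           SatLit x l ⊎ SatLit y l → SatLit (meetOn V₀ x y) l
  satLit-meetOn-negative {l} l∈V₀ l⁻ (inj₁ x⊨l) =
    trans (lookup-meetOn-∈ V₀ x y l∈V₀) (trans (cong (_∧ lookup y (var l)) (trans x⊨l l⁻)) (sym l⁻))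
  satLit-meetOn-negative {l} l∈V₀ l⁻ (inj₂ y⊨l) =
    trans (lookup-meetOn-∈ V₀ x y l∈V₀)
          (trans (cong (lookup x (var l) ∧_) (trans y⊨l l⁻)) (trans (∧-zeroʳ _) (sym l⁻)))

  sat-meetOn-negative : ∀ {c} → All (InSet V₀) c → All Negative c →
                        SatClause x c ⊎ SatClause y c → SatClause (meetOn V₀ x y) c
  sat-meetOn-negative c∈V₀ c⁻ (inj₁ x⊨c) =
    Any-mapAll (All.zipWith (λ (l∈V₀ , l⁻) → satLit-meetOn-negative l∈V₀ l⁻ ∘ inj₁) (c∈V₀ , c⁻)) x⊨c
  sat-meetOn-negative c∈V₀ c⁻ (inj₂ y⊨c) =
    Any-mapAll (All.zipWith (λ (l∈V₀ , l⁻) → satLit-meetOn-negative l∈V₀ l⁻ ∘ inj₂) (c∈V₀ , c⁻)) y⊨c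

  sat-meetOn-inside : ∀ c → All (InSet V₀) c → HornClause c →
                      SatClause x c → SatClause y c → SatClause (meetOn V₀ x y) c
  sat-meetOn-inside (lit v true ∷ c) (v∈V₀ ∷ _) _ (here x⊨v) (here y⊨v) =
    here (satLit-meetOn-both v∈V₀ x⊨v y⊨v)
  sat-meetOn-inside (lit v true ∷ c) (_ ∷ c∈V₀) (s≤s c⁻) (here _) (there y⊨c) =
    there (sat-meetOn-negative c∈V₀ (negative-posLits c c⁻) (inj₂ y⊨c))
  sat-meetOn-inside (lit v true ∷ c) (_ ∷ c∈V₀) (s≤s c⁻) (there x⊨c) _ =
    there (sat-meetOn-negative c∈V₀ (negative-posLits c c⁻) (inj₁ x⊨c))
  sat-meetOn-inside (lit v false ∷ c) (v∈V₀ ∷ _) _ (here x⊨v) _ =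
    here (satLit-meetOn-negative v∈V₀ refl (inj₁ x⊨v))
  sat-meetOn-inside (lit v false ∷ c) (v∈V₀ ∷ _) _ (there _) (here y⊨v) =
    here (satLit-meetOn-negative v∈V₀ refl (inj₂ y⊨v))
  sat-meetOn-inside (lit v false ∷ c) (_ ∷ c∈V₀) horn (there x⊨c) (there y⊨c) =
    there (sat-meetOn-inside c c∈V₀ horn x⊨c y⊨c)

  satLit-meetOn-negativeInside : ∀ {l} → (InSet V₀ l → Negative l) → SatLit x l → SatLit (meetOn V₀ x y) l
  satLit-meetOn-negativeInside {l} l⁻ x⊨l with V₀ (var l) ≟ᵇ true
  ... | yes l∈V₀ = satLit-meetOn-negative l∈V₀ (l⁻ l∈V₀) (inj₁ x⊨l)
  ... | no  l∉V₀ = satLit-meetOn-∉ (¬-not l∉V₀) x⊨l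

  sat-meetOn : ∀ {c} → PartiallyHornClause V₀ c →
               SatClause x c → SatClause y c → SatClause (meetOn V₀ x y) c
  sat-meetOn {c} (horn , neg) x⊨c y⊨c with Any.any? (λ l → V₀ (var l) ≟ᵇ false) c
  ... | yes outside = Any-mapAll (All.map satLit-meetOn-negativeInside (neg outside)) x⊨c
  ... | no ¬outside = sat-meetOn-inside c c∈V₀ (horn c∈V₀) x⊨c y⊨c
    where c∈V₀ = All.map ¬-not (Allₚ.¬Any⇒All¬ c ¬outside)

  models-meetOn : ∀ {φ} → All (PartiallyHornClause V₀) φ →
                  Models φ x → Models φ y → Models φ (meetOn V₀ x y)
  models-meetOn []       []         []         = []
  models-meetOn (h ∷ hs) (x⊨c ∷ x⊨φ) (y⊨c ∷ y⊨φ) = sat-meetOn h x⊨c y⊨c ∷ models-meetOn hs x⊨φ y⊨φ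

closedUnder-meetOn : ∀ {V₀ : VarSet n} {φ D} → All (PartiallyHornClause V₀) φ →
                     ModelsEq φ D → ClosedUnder D (meetOn V₀)
closedUnder-meetOn hs φ≈D x y x∈D y∈D =
  Equivalence.from (φ≈D _)
    (models-meetOn {x = x} {y} hs (Equivalence.to (φ≈D x) x∈D) (Equivalence.to (φ≈D y) y∈D))

hornAggregatorBit : Bool → Bool → Bool → Bool → Bool
hornAggregatorBit true  true  a b = a ∨ b
hornAggregatorBit true  false a b = a ∧ b
hornAggregatorBit false _     a b = a

hornAggregator : VarSet n → VarSet n → Fin n → Bool → Bool → Bool
hornAggregator V₀ W j = hornAggregatorBit (V₀ j) (W j)

hornAggregatorBit-unanimous : ∀ v w → Unanimous (hornAggregatorBit v w)
hornAggregatorBit-unanimous true  true  = ∨-idem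
hornAggregatorBit-unanimous true  false = ∧-idem
hornAggregatorBit-unanimous false _     _ = refl

hornAggregatorBit-not-projection : ∀ w → ¬ IsProjection (hornAggregatorBit true w)
hornAggregatorBit-not-projection true  (isPr₁ pr₁) = case pr₁ false true of λ ()
hornAggregatorBit-not-projection true  (isPr₂ pr₂) = case pr₂ true false of λ ()
hornAggregatorBit-not-projection false (isPr₁ pr₁) = case pr₁ true false of λ ()
hornAggregatorBit-not-projection false (isPr₂ pr₂) = case pr₂ false true of λ ()

hornAggregatorBit-renamed : ∀ v w a b →
  hornAggregatorBit v w a b ≡ w xor meetIf v (w xor a) (w xor b)
hornAggregatorBit-renamed true  true  true  _     = refl
hornAggregatorBit-renamed true  true  false true  = refl
hornAggregatorBit-renamed true  true  false false = refl
hornAggregatorBit-renamed true  false a     b     = refl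
hornAggregatorBit-renamed false w     a     b     = sym (xor-involutive w a)

applyAgg-hornAggregator : ∀ (V₀ W : VarSet n) x y →
  applyAgg (hornAggregator V₀ W) x y ≡ renamePoint W (meetOn V₀ (renamePoint W x) (renamePoint W y))
applyAgg-hornAggregator V₀ W x y = pointwise⇒≡ λ j → begin
  lookup (applyAgg (hornAggregator V₀ W) x y) j
    ≡⟨ lookup-applyAgg (hornAggregator V₀ W) x y j ⟩
  hornAggregatorBit (V₀ j) (W j) (lookup x j) (lookup y j)
    ≡⟨ hornAggregatorBit-renamed (V₀ j) (W j) (lookup x j) (lookup y j) ⟩
  W j xor meetIf (V₀ j) (W j xor lookup x j) (W j xor lookup y j)
    ≡⟨ cong (W j xor_) (sym (trans (lookup-meetOn V₀ X Y j)
                  (cong₂ (meetIf (V₀ j)) (lookup-renamePoint W x j) (lookup-renamePoint W y j)))) ⟩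
  W j xor lookup (meetOn V₀ X Y) j
    ≡⟨ lookup-renamePoint W (meetOn V₀ X Y) j ⟨
  lookup (renamePoint W (meetOn V₀ X Y)) j ∎
  where
  open ≡-Reasoning
  X = renamePoint W x
  Y = renamePoint W y

aggregator-of-renamablePartiallyHorn : ∀ {D : Domain n} →
  (Σ (CNF n) λ φ → RenamablePartiallyHorn φ × ModelsEq φ D) →
  (Σ (Fin n → Bool → Bool → Bool) λ f → IsBinaryAggregator D f × ¬ IsProjectionAggregator f)
aggregator-of-renamablePartiallyHorn {D = D} (φ , (W , V₀ , horn) , φ≈D) =
  hornAggregator V₀ W , ((λ j → hornAggregatorBit-unanimous (V₀ j) (W j)) , closed) , notProjection
  where
  j₀,∈V₀ = proj₁ (Equivalence.to partiallyHornWith⇔ horn)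
  j₀ = proj₁ j₀,∈V₀

  closedRenamed : ClosedUnder (D ∘ renamePoint W) (meetOn V₀)
  closedRenamed =
    closedUnder-meetOn (proj₂ (Equivalence.to partiallyHornWith⇔ horn)) (modelsEq-rename W φ≈D)

  renamed-∈ : ∀ {x} → x ∈D D → renamePoint W x ∈D (D ∘ renamePoint W)
  renamed-∈ {x} = subst (_∈D D) (sym (renamePoint-involutive W x))

  closed : ClosedUnder D (applyAgg (hornAggregator V₀ W))
  closed x y x∈D y∈D = subst (_∈D D) (sym (applyAgg-hornAggregator V₀ W x y))
    (closedRenamed (renamePoint W x) (renamePoint W y) (renamed-∈ x∈D) (renamed-∈ y∈D))

  notProjection : ¬ IsProjectionAggregator (hornAggregator V₀ W)
  notProjection isProj =
    hornAggregatorBit-not-projection (W j₀)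
      (subst (λ v → IsProjection (hornAggregatorBit v (W j₀))) (proj₂ j₀,∈V₀) (isProj j₀))

unanimousOp : Bool → Bool → Bool → Bool → Bool
unanimousOp p q true  true  = true
unanimousOp p q true  false = p
unanimousOp p q false true  = q
unanimousOp p q false false = false

unanimous⇒unanimousOp : ∀ f → Unanimous f → ∀ a b → f a b ≡ unanimousOp (f true false) (f false true) a b
unanimous⇒unanimousOp f f-un true  true  = f-un true
unanimous⇒unanimousOp f f-un true  false = refl
unanimous⇒unanimousOp f f-un false true  = refl
unanimous⇒unanimousOp f f-un false false = f-un false

asymmetric⇒projection : ∀ f → Unanimous f → not (f true false xor f false true) ≡ false → IsProjection f
asymmetric⇒projection f f-un asym with f true false in f₁₀ | f false true in f₀₁
... | true  | false = isPr₁ λ { true true → f-un true ; true false → f₁₀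
                             ; false true → f₀₁ ; false false → f-un false }
... | false | true  = isPr₂ λ { true true → f-un true ; true false → f₁₀
                             ; false true → f₀₁ ; false false → f-un false }

unanimousOp-selfComposition : ∀ p q a b →
  (p ∧ q) xor meetIf (not (p xor q)) a b ≡
  unanimousOp p q (unanimousOp p q ((p ∧ q) xor a) ((p ∧ q) xor b))
                  (unanimousOp p q ((p ∧ q) xor b) ((p ∧ q) xor a))
unanimousOp-selfComposition true  true  true  true  = refl
unanimousOp-selfComposition true  true  true  false = refl
unanimousOp-selfComposition true  true  false true  = refl
unanimousOp-selfComposition true  true  false false = refl
unanimousOp-selfComposition true  false true  true  = refl
unanimousOp-selfComposition true  false true  false = refl
unanimousOp-selfComposition true  false false true  = refl
unanimousOp-selfComposition true  false false false = refl
unanimousOp-selfComposition false true  true  true  = refl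
unanimousOp-selfComposition false true  true  false = refl
unanimousOp-selfComposition false true  false true  = refl
unanimousOp-selfComposition false true  false false = refl
unanimousOp-selfComposition false false true  true  = refl
unanimousOp-selfComposition false false true  false = refl
unanimousOp-selfComposition false false false true  = refl
unanimousOp-selfComposition false false false false = refl

symmetricCoords : (Fin n → Bool → Bool → Bool) → VarSet n
symmetricCoords f j = not (f j true false xor f j false true)

disjunctiveCoords : (Fin n → Bool → Bool → Bool) → VarSet n
disjunctiveCoords f j = f j true false ∧ f j false true

selfComposition : (Fin n → Bool → Bool → Bool) → Point n → Point n → Point n
selfComposition f x y = applyAgg f (applyAgg f x y) (applyAgg f y x)

lookup-selfComposition : ∀ (f : Fin n → Bool → Bool → Bool) x y j →
  lookup (selfComposition f x y) j ≡ f j (f j (lookup x j) (lookup y j)) (f j (lookup y j) (lookup x j))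
lookup-selfComposition f x y j =
  trans (lookup-applyAgg f (applyAgg f x y) (applyAgg f y x) j)
        (cong₂ (f j) (lookup-applyAgg f x y j) (lookup-applyAgg f y x j))

unanimous-selfComposition : ∀ f → Unanimous f → ∀ a b →
  f (f a b) (f b a) ≡ unanimousOp (f true false) (f false true)
                        (unanimousOp (f true false) (f false true) a b)
                        (unanimousOp (f true false) (f false true) b a)
unanimous-selfComposition f f-un a b =
  trans (unanimous⇒unanimousOp f f-un _ _)
        (cong₂ (unanimousOp _ _) (unanimous⇒unanimousOp f f-un a b) (unanimous⇒unanimousOp f f-un b a))

renamePoint-meetOn : ∀ (f : Fin n → Bool → Bool → Bool) → (∀ j → Unanimous (f j)) → ∀ x y →
  let W = disjunctiveCoords f in
  renamePoint W (meetOn (symmetricCoords f) x y) ≡ selfComposition f (renamePoint W x) (renamePoint W y)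
renamePoint-meetOn f f-un x y = pointwise⇒≡ λ j → begin
  lookup (renamePoint W (meetOn V₀ x y)) j
    ≡⟨ lookup-renamePoint W (meetOn V₀ x y) j ⟩
  W j xor lookup (meetOn V₀ x y) j
    ≡⟨ cong (W j xor_) (lookup-meetOn V₀ x y j) ⟩
  W j xor meetIf (V₀ j) (lookup x j) (lookup y j)
    ≡⟨ unanimousOp-selfComposition (f j true false) (f j false true) (lookup x j) (lookup y j) ⟩
  _
    ≡⟨ unanimous-selfComposition (f j) (f-un j) (W j xor lookup x j) (W j xor lookup y j) ⟨
  f j (f j (W j xor lookup x j) (W j xor lookup y j)) (f j (W j xor lookup y j) (W j xor lookup x j))
    ≡⟨ cong₂ (λ a b → f j (f j a b) (f j b a)) (lookup-renamePoint W x j) (lookup-renamePoint W y j) ⟨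
  _
    ≡⟨ lookup-selfComposition f (renamePoint W x) (renamePoint W y) j ⟨
  lookup (selfComposition f (renamePoint W x) (renamePoint W y)) j ∎
  where
  open ≡-Reasoning
  W = disjunctiveCoords f
  V₀ = symmetricCoords f

allPoints : ∀ n → List (Point n)
allPoints zero    = [] ∷ []
allPoints (suc n) = map (true ∷_) (allPoints n) ++ map (false ∷_) (allPoints n)

∈-allPoints : (x : Point n) → x ∈ allPoints n
∈-allPoints []                 = here refl
∈-allPoints (true ∷ x)         = ∈-++⁺ˡ (∈-map⁺ (true ∷_) (∈-allPoints x))
∈-allPoints {suc n} (false ∷ x) = ∈-++⁺ʳ (map (true ∷_) (allPoints n)) (∈-map⁺ (false ∷_) (∈-allPoints x))

∃-point? : {P : Point n → Set} → (∀ x → Dec (P x)) → Dec (∃ P)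
∃-point? P? = map′ Any.satisfied (λ (x , px) → lose (∈-allPoints x) px) (Any.any? P? (allPoints _))

satClause? : ∀ (x : Point n) c → Dec (SatClause x c)
satClause? x = Any.any? λ l → lookup x (var l) ≟ᵇ positive l

AgreeOn : (Fin n → Set) → Point n → Point n → Set
AgreeOn P x z = ∀ j → P j → lookup x j ≡ lookup z j

agreeOn? : {P : Fin n → Set} → (∀ j → Dec (P j)) → ∀ x z → Dec (AgreeOn P x z)
agreeOn? P? x z = all? λ j → P? j →-dec (lookup x j ≟ᵇ lookup z j)

differsOn : Point n → {P : Fin n → Set} → (∀ j → Dec (P j)) → Clause n
differsOn z P? = map (λ j → lit j (not (lookup z j))) (filter P? (allFin _))

module _ (z : Point n) {P : Fin n → Set} (P? : ∀ j → Dec (P j)) where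

  All-differsOn : {Q : Literal n → Set} → (∀ j → P j → Q (lit j (not (lookup z j)))) → All Q (differsOn z P?)
  All-differsOn {Q} Q-lit = All.tabulate λ l∈ → let j , j∈ , l≡ = ∈-map⁻ _ l∈ in
    subst Q (sym l≡) (Q-lit j (proj₂ (∈-filter⁻ P? {xs = allFin _} j∈)))

  differsOn-excludes : ¬ SatClause z (differsOn z P?)
  differsOn-excludes = Allₚ.All¬⇒¬Any (All-differsOn λ j _ → not-¬ refl)

  ¬differsOn⇒agreeOn : ∀ {x} → ¬ SatClause x (differsOn z P?) → AgreeOn P x z
  ¬differsOn⇒agreeOn {x} x⊭c j pj with lookup x j ≟ᵇ lookup z j
  ... | yes xj≡zj = xj≡zj
  ... | no  xj≢zj = ⊥-elim (x⊭c (lose (∈-map⁺ _ (∈-filter⁺ P? (∈-allFin j) pj)) (¬-not xj≢zj)))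

module PartiallyHornDefinition (E : Domain n) (V₀ : VarSet n) (j₀ : Fin n) (j₀∈V₀ : V₀ j₀ ≡ true)
                               (closed : ClosedUnder E (meetOn V₀)) where

  Frame : Point n → Fin n → Set
  Frame z j = V₀ j ≡ true → lookup z j ≡ true

  OnesOf : Point n → Fin n → Set
  OnesOf z j = V₀ j ≡ true × lookup z j ≡ true

  frame? : ∀ z j → Dec (Frame z j)
  frame? z j = (V₀ j ≟ᵇ true) →-dec (lookup z j ≟ᵇ true)

  onesOf? : ∀ z j → Dec (OnesOf z j)
  onesOf? z j = (V₀ j ≟ᵇ true) ×-dec (lookup z j ≟ᵇ true)

  -- AgreeOn (Frame z) y z: y equals z off V₀ and lies above z on V₀.
  Above : Point n → Point n → Set
  Above z y = y ∈D E × AgreeOn (Frame z) y z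

  Escapes : Point n → Fin n → Point n → Set
  Escapes z k y = y ∈D E × AgreeOn (OnesOf z) y z × lookup y k ≡ false

  Forced : Point n → Fin n → Set
  Forced z k = V₀ k ≡ true × lookup z k ≡ false × ¬ ∃ (Escapes z k)

  above? : ∀ z → Dec (∃ (Above z))
  above? z = ∃-point? λ y → (E y ≟ᵇ true) ×-dec agreeOn? (frame? z) y z

  escapes? : ∀ z k → Dec (∃ (Escapes z k))
  escapes? z k = ∃-point? λ y → (E y ≟ᵇ true) ×-dec (agreeOn? (onesOf? z) y z ×-dec (lookup y k ≟ᵇ false))

  forced? : ∀ z → Dec (∃ (Forced z))
  forced? z = any? λ k → (V₀ k ≟ᵇ true) ×-dec ((lookup z k ≟ᵇ false) ×-dec ¬? (escapes? z k))

  meetOn-above : ∀ z x y → AgreeOn (Frame z) x z → AgreeOn (OnesOf z) y z →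
                 AgreeOn (Frame z) (meetOn V₀ x y) z
  meetOn-above z x y x≈z y≈z j frame with V₀ j ≟ᵇ true
  ... | yes j∈V₀ = trans (lookup-meetOn-∈ V₀ x y j∈V₀)
                         (trans (cong₂ _∧_ (x≈z j frame) (y≈z j (j∈V₀ , frame j∈V₀))) (∧-idem (lookup z j)))
  ... | no  j∉V₀ = trans (lookup-meetOn-∉ V₀ x y (¬-not j∉V₀)) (x≈z j frame)

  ZeroOn : List (Fin n) → Point n → Point n → Set
  ZeroOn L z x = ∀ j → j ∈ L → V₀ j ≡ true → lookup z j ≡ false → lookup x j ≡ false

  approximate : ∀ z → ∃ (Above z) → (∀ k → V₀ k ≡ true → lookup z k ≡ false → ∃ (Escapes z k)) →
                ∀ L → ∃ λ x → Above z x × ZeroOn L z x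
  approximate z (s , s-above) escape [] = s , s-above , λ _ ()
  approximate z above escape (k ∷ L) with approximate z above escape L | (V₀ k ≟ᵇ true) ×-dec (lookup z k ≟ᵇ false)
  ... | x , x-above , x-zero | no ¬zero =
    x , x-above , λ { j (here refl) j∈V₀ zj → ⊥-elim (¬zero (j∈V₀ , zj)) ; j (there j∈L) → x-zero j j∈L }
  ... | x , (x∈E , x≈z) , x-zero | yes (k∈V₀ , zk) with escape k k∈V₀ zk
  ...   | y , y∈E , y≈z , yk = meetOn V₀ x y , (closed x y x∈E y∈E , meetOn-above z x y x≈z y≈z) , zeros
    where
    zeros : ZeroOn (k ∷ L) z (meetOn V₀ x y)
    zeros j (here refl) j∈V₀ _ =
      trans (lookup-meetOn-∈ V₀ x y j∈V₀) (trans (cong (lookup x j ∧_) yk) (∧-zeroʳ _))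
    zeros j (there j∈L) j∈V₀ zj =
      trans (lookup-meetOn-∈ V₀ x y j∈V₀) (cong (_∧ lookup y j) (x-zero j j∈L j∈V₀ zj))

  ∈E-of-escapes : ∀ z → ∃ (Above z) → (∀ k → V₀ k ≡ true → lookup z k ≡ false → ∃ (Escapes z k)) → z ∈D E
  ∈E-of-escapes z above escape =
    let x , (x∈E , x≈z) , x-zero = approximate z above escape (allFin n) in
    subst (_∈D E) (pointwise⇒≡ (x≡z {x} x≈z x-zero)) x∈E
    where
    x≡z : ∀ {x} → AgreeOn (Frame z) x z → ZeroOn (allFin n) z x → ∀ j → lookup x j ≡ lookup z j
    x≡z x≈z x-zero j with V₀ j ≟ᵇ true | lookup z j ≟ᵇ true
    ... | no  j∉V₀ | _      = x≈z j (⊥-elim ∘ j∉V₀)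
    ... | yes _    | yes zj = x≈z j (λ _ → zj)
    ... | yes j∈V₀ | no  zj = trans (x-zero j (∈-allFin j) j∈V₀ (¬-not zj)) (sym (¬-not zj))

  fibreClause : Point n → Clause n
  fibreClause z = differsOn z (frame? z)

  implicationClause : Point n → Fin n → Clause n
  implicationClause z k = lit k true ∷ differsOn z (onesOf? z)

  tautology : Clause n
  tautology = lit j₀ true ∷ lit j₀ false ∷ []

  clauseFor : ∀ z → Dec (∃ (Above z)) → Dec (∃ (Forced z)) → Clause n
  clauseFor z (no  _) _            = fibreClause z
  clauseFor z (yes _) (yes (k , _)) = implicationClause z k
  clauseFor z (yes _) (no  _)       = tautology

  clauseFor-partiallyHorn : ∀ z a f → PartiallyHornClause V₀ (clauseFor z a f)
  clauseFor-partiallyHorn z (no _) _ =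
    negativeInside⇒partiallyHorn (All-differsOn z (frame? z) λ j frame j∈V₀ → cong not (frame j∈V₀))
  clauseFor-partiallyHorn z (yes _) (yes (k , k∈V₀ , _)) =
    inside⇒partiallyHorn (k∈V₀ ∷ All-differsOn z (onesOf? z) λ j (j∈V₀ , _) → j∈V₀)
                         (horn-∷-negative k (All-differsOn z (onesOf? z) λ j (_ , zj) → cong not zj))
  clauseFor-partiallyHorn z (yes _) (no _) = inside⇒partiallyHorn (j₀∈V₀ ∷ j₀∈V₀ ∷ []) (s≤s z≤n)

  clauseFor-valid : ∀ {x} z a f → x ∈D E → SatClause x (clauseFor z a f)
  clauseFor-valid {x} z (no ¬above) _ x∈E with satClause? x (fibreClause z)
  ... | yes x⊨c = x⊨c
  ... | no  x⊭c = ⊥-elim (¬above (x , x∈E , ¬differsOn⇒agreeOn z (frame? z) {x} x⊭c))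
  clauseFor-valid {x} z (yes _) (yes (k , _ , _ , ¬escape)) x∈E
    with satClause? x (differsOn z (onesOf? z)) | lookup x k ≟ᵇ true
  ... | yes x⊨c | _      = there x⊨c
  ... | no  _   | yes xk = here xk
  ... | no  x⊭c | no  xk = ⊥-elim (¬escape (x , x∈E , ¬differsOn⇒agreeOn z (onesOf? z) {x} x⊭c , ¬-not xk))
  clauseFor-valid {x} z (yes _) (no _) _ with lookup x j₀ ≟ᵇ true
  ... | yes xj₀ = here xj₀
  ... | no  xj₀ = there (here (¬-not xj₀))

  clauseFor-excludes : ∀ z a f → E z ≡ false → ¬ SatClause z (clauseFor z a f)
  clauseFor-excludes z (no _) _ _ = differsOn-excludes z (frame? z)
  clauseFor-excludes z (yes _) (yes (k , _ , zk , _)) _ (here zk′) = not-¬ zk zk′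
  clauseFor-excludes z (yes _) (yes _) _ (there z⊨c) = differsOn-excludes z (onesOf? z) z⊨c
  clauseFor-excludes z (yes above) (no ¬forced) z∉E _ = not-¬ z∉E (∈E-of-escapes z above escape)
    where
    escape : ∀ k → V₀ k ≡ true → lookup z k ≡ false → ∃ (Escapes z k)
    escape k k∈V₀ zk with escapes? z k
    ... | yes e  = e
    ... | no  ¬e = ⊥-elim (¬forced (k , k∈V₀ , zk , ¬e))

  formula : CNF n
  formula = map (λ z → clauseFor z (above? z) (forced? z)) (allPoints n)

  formula-partiallyHorn : PartiallyHornWith V₀ formula
  formula-partiallyHorn = Equivalence.from partiallyHornWith⇔
    ((j₀ , j₀∈V₀) , Allₚ.map⁺ (All.universal (λ z → clauseFor-partiallyHorn z (above? z) (forced? z)) _))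

  formula-modelsEq : ModelsEq formula E
  formula-modelsEq x =
    mk⇔ (λ x∈E → Allₚ.map⁺ (All.universal (λ z → clauseFor-valid z (above? z) (forced? z) x∈E) _)) ∈E
    where
    ∈E : Models formula x → x ∈D E
    ∈E x⊨formula with E x ≟ᵇ true
    ... | yes x∈E = x∈E
    ... | no  x∉E = ⊥-elim (clauseFor-excludes x (above? x) (forced? x) (¬-not x∉E)
                              (All.lookup (Allₚ.map⁻ x⊨formula) (∈-allPoints x)))

closedUnder-meetOn-renamed : ∀ {D : Domain n} {f} → IsBinaryAggregator D f →
  ClosedUnder (D ∘ renamePoint (disjunctiveCoords f)) (meetOn (symmetricCoords f))
closedUnder-meetOn-renamed {D = D} {f} (f-un , f-closed) x y x∈ y∈ =
  subst (_∈D D) (sym (renamePoint-meetOn f f-un x y))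
        (f-closed _ _ (f-closed _ _ x∈ y∈) (f-closed _ _ y∈ x∈))

symmetricCoord-of-nonProjection : ∀ {f : Fin n → Bool → Bool → Bool} → (∀ j → Unanimous (f j)) →
  ¬ IsProjectionAggregator f → ∃ λ j → symmetricCoords f j ≡ true
symmetricCoord-of-nonProjection {f = f} f-un ¬proj with any? (λ j → symmetricCoords f j ≟ᵇ true)
... | yes j = j
... | no ¬j = ⊥-elim (¬proj λ j → asymmetric⇒projection (f j) (f-un j) (¬-not λ j∈ → ¬j (j , j∈)))

renamablePartiallyHorn-of-aggregator : ∀ {D : Domain n} →
  (Σ (Fin n → Bool → Bool → Bool) λ f → IsBinaryAggregator D f × ¬ IsProjectionAggregator f) →
  (Σ (CNF n) λ φ → RenamablePartiallyHorn φ × ModelsEq φ D)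
renamablePartiallyHorn-of-aggregator {D = D} (f , agg , ¬proj) =
  rename W formula ,
  (W , V₀ , subst (PartiallyHornWith V₀) (sym (rename-involutive W formula)) formula-partiallyHorn) ,
  modelsEq-resp (λ x → cong D (renamePoint-involutive W x)) (modelsEq-rename W formula-modelsEq)
  where
  W = disjunctiveCoords f
  V₀ = symmetricCoords f
  j₀,∈V₀ = symmetricCoord-of-nonProjection (proj₁ agg) ¬proj
  open PartiallyHornDefinition (D ∘ renamePoint W) V₀ (proj₁ j₀,∈V₀) (proj₂ j₀,∈V₀)
                               (closedUnder-meetOn-renamed {f = f} agg)

theorem4p3 : (n : ℕ) (D : Domain n) → NonDegenerate D →
    (Σ (Fin n → Bool → Bool → Bool) λ f → IsBinaryAggregator D f × ¬ IsProjectionAggregator f)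
    ⇔ (Σ (CNF n) λ φ → RenamablePartiallyHorn φ × ModelsEq φ D)
theorem4p3 n D _ = mk⇔ renamablePartiallyHorn-of-aggregator aggregator-of-renamablePartiallyHorn
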